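{- Let $G$ be a graph with a universal node $u$ (a node adjacent to all other nodes of $G$). If the graph $G'$ obtained from $G$ by removing $u$ is a PCG, then $G$ is a 2-interval PCG.
   Context: Graphs are finite and simple. For a tree $T$ with non-negative real edge weights whose leaves are identified with the nodes of a graph, $d_T(u,v)$ denotes the weighted distance in $T$ between the leaves associated to $u$ and $v$. A graph $G=(V,E)$ is a PCG (pairwise compatibility graph) if there exist a tree $T$ with non-negative real edge weights, a bijection between $V$ and the leaves of $T$, and an interval $I$ of the non-negative real half-line such that for distinct $u,v\in V$, $(u,v)\in E$ if and only if $d_T(u,v)\in I$. A graph is a 2-interval PCG if the same holds with two disjoint intervals $I_1,I_2$ of the non-negative real half-line in place of $I$, with the condition $d_T(u,v)\in I_1\cup I_2$.
   Formalization: The edge weights of the trees are non-negative rationals rather than non-negative reals, and the intervals have rational endpoints. -}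

module Defs where

open import Data.Nat using (ℕ; suc) renaming (_≤_ to _ℕ≤_)
open import Data.Fin using (Fin; punchIn)
open import Data.List using (List; []; _∷_; length)
open import Data.List.Relation.Unary.Unique.Propositional using (Unique)
open import Data.Rational using (ℚ; 0ℚ; _+_; _≤_; _<_)
open import Data.Product using (Σ; proj₁; ∃; ∃-syntax; _×_; _,_)
open import Data.Sum using (_⊎_)
open import Data.Empty using (⊥)
open import Relation.Nullary using (¬_)
open import Relation.Binary.PropositionalEquality using (_≡_)
open import Function.Bundles using (_⇔_)
open import Level using (0ℓ) renaming (suc to lsuc)

record Graph (k : ℕ) : Set₁ where
  field
    Adj    : Fin k → Fin k → Set
    sym    : ∀ {x y} → Adj x y → Adj y x
    irrefl : ∀ {x} → ¬ Adj x x
open Graph public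

Universal : ∀ {k} → Graph k → Fin k → Set
Universal G u = ∀ v → ¬ (v ≡ u) → Adj G u v

removeNode : ∀ {k} → Graph (suc k) → Fin (suc k) → Graph k
removeNode G u = record
  { Adj    = λ i j → Adj G (punchIn u i) (punchIn u j)
  ; sym    = sym G
  ; irrefl = irrefl G
  }

module _ {m : ℕ} (A : Fin m → Fin m → Set) where

  data Walk : Fin m → Fin m → Set where
    []  : ∀ {x} → Walk x x
    _∷_ : ∀ {x y z} → A x y → Walk y z → Walk x z

  verts : ∀ {x y} → Walk x y → List (Fin m)
  verts ([] {x})    = x ∷ []
  verts (_∷_ {x} _ p) = x ∷ verts p

  Path : Fin m → Fin m → Set
  Path x y = Σ (Walk x y) λ p → Unique (verts p)

  Connected : Set
  Connected = ∀ x y → Path x y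

  -- a cycle: a path x ... y with at least 3 vertices plus an edge y x
  Acyclic : Set
  Acyclic = ∀ x y → (p : Path x y) →
            3 ℕ≤ length (verts (proj₁ p)) → ¬ A y x

record WTree : Set₁ where
  field
    size      : ℕ
    E         : Fin size → Fin size → Set
    E-sym     : ∀ {x y} → E x y → E y x
    E-irrefl  : ∀ {x} → ¬ E x x
    connected : Connected E
    acyclic   : Acyclic E
    w         : Fin size → Fin size → ℚ
    w-sym     : ∀ x y → w x y ≡ w y x
    w-nonneg  : ∀ x y → 0ℚ ≤ w x y
open WTree public

weight : (T : WTree) → ∀ {x y} → Walk (E T) x y → ℚ
weight T []              = 0ℚ
weight T (_∷_ {x} {y} _ p) = w T x y + weight T p

-- leaf: node of degree at most 1 (degree 1 when the tree has >= 2 nodes;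
-- the single node of a one-node tree also counts as a leaf)
Leaf : (T : WTree) → Fin (size T) → Set
Leaf T x = ∀ y z → E T x y → E T x z → y ≡ z

data Bound : Set where
  closedB openB : ℚ → Bound
  unbounded   : Bound

-- An interval of the non-negative half-line: the intersection of
-- [0, ∞) with an interval given by a lower and an upper bound
-- (each closed, open, or absent).  Every interval of the non-negative
-- reals with rational endpoints arises this way (including empty ones).
record Interval : Set where
  constructor interval
  field
    lower upper : Bound
open Interval public

AboveL : Bound → ℚ → Set
AboveL (closedB a) x = a ≤ x
AboveL (openB a)   x = a < x
AboveL unbounded  x = 0ℚ ≤ x

BelowU : Bound → ℚ → Set
BelowU (closedB b) x = x ≤ b
BelowU (openB b)   x = x < b
BelowU unbounded  x = 0ℚ ≤ x

_∈I_ : ℚ → Interval → Set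
x ∈I I = (0ℚ ≤ x) × AboveL (lower I) x × BelowU (upper I) x

record LeafLabelling (k : ℕ) (T : WTree) : Set where
  field
    ℓ        : Fin k → Fin (size T)
    ℓ-inj    : ∀ a b → ℓ a ≡ ℓ b → a ≡ b
    ℓ-leaf   : ∀ a → Leaf T (ℓ a)
    ℓ-onto   : ∀ x → Leaf T x → ∃[ a ] ℓ a ≡ x
open LeafLabelling public

-- d_T(ℓ a, ℓ b) ∈ S, where d_T is the weight of the (unique) path
-- between the two leaves in T
DistIn : (T : WTree) → Fin (size T) → Fin (size T) → (ℚ → Set) → Set
DistIn T x y S = Σ (Path (E T) x y) λ p → S (weight T (proj₁ p))

IsPCG : ∀ {k} → Graph k → Set₁
IsPCG {k} G =
  Σ WTree λ T → Σ (LeafLabelling k T) λ L → Σ Interval λ I →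
    ∀ a b → ¬ (a ≡ b) →
      (Adj G a b ⇔ DistIn T (ℓ L a) (ℓ L b) (λ r → r ∈I I))

Is2IntervalPCG : ∀ {k} → Graph k → Set₁
Is2IntervalPCG {k} G =
  Σ WTree λ T → Σ (LeafLabelling k T) λ L →
  Σ Interval λ I₁ → Σ Interval λ I₂ →
    (∀ r → ¬ (r ∈I I₁ × r ∈I I₂)) ×
    (∀ a b → ¬ (a ≡ b) →
      (Adj G a b ⇔ DistIn T (ℓ L a) (ℓ L b) (λ r → r ∈I I₁ ⊎ r ∈I I₂)))

-- Vertex 0 of G − u sits at a leaf c of the tree T of a PCG model with interval I.
-- Hang two pendant leaves at c: p with weight 0, which takes over vertex 0, and q,
-- for u, with a weight D > K, where K bounds all path weights of T and the endpoints
-- of I.  Distances among the vertices of G − u do not change and are at most K,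
-- while every distance from q exceeds K; so I together with the part of (K, ∞)
-- that I misses is a 2-interval model of G.

module Submission where

open import Defs
open import Data.Nat as ℕ using (ℕ; suc; s≤s; z≤n)
import Data.Nat.Properties as ℕ
open import Data.Fin as Fin using (Fin; zero; suc; punchIn)
open import Data.Fin.Properties using (0≢1+n; suc-injective; punchInᵢ≢i; pigeonhole; lift-injective; <⇒≢)
open import Data.Fin.Permutation using (Permutation′; _⟨$⟩ʳ_; _⟨$⟩ˡ_; inverseˡ; inverseʳ; insert; id)
open import Data.List as List using (List; []; _∷_; _∷ʳ_; length; map; lookup; allFin; cartesianProduct)
open import Data.List.Properties using (length-map; length-reverse; unfold-reverse)
open import Data.List.Membership.Propositional using (_∈_)
open import Data.List.Membership.Propositional.Properties using (∈-lookup; ∈-map⁺; ∈-cartesianProduct⁺; ∈-allFin)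
open import Data.List.Relation.Unary.All as All using (All; []; _∷_)
open import Data.List.Relation.Unary.Any using (here; there)
open import Data.List.Relation.Unary.AllPairs using ([]; _∷_)
open import Data.List.Relation.Unary.Unique.Propositional using (Unique)
open import Data.List.Relation.Unary.Unique.Propositional.Properties using (map⁺; map⁻; Unique[x∷xs]⇒x∉xs)
open import Data.List.Relation.Binary.Permutation.Propositional using (↭-sym; ↭⇒↭ₛ)
open import Data.List.Relation.Binary.Permutation.Propositional.Properties using (↭-reverse)
import Data.List.Relation.Binary.Permutation.Setoid.Properties as Permutation
open import Data.Rational as ℚ using (ℚ; 0ℚ; 1ℚ; _+_; _≤_; _<_; _⊔_)
import Data.Rational.Properties as ℚ
open import Relation.Binary.Bundles using (DecTotalOrder)
open import Data.List.Extrema (DecTotalOrder.totalOrder ℚ.≤-decTotalOrder) using (max; xs≤max; ⊥≤max)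
open import Algebra.Definitions.RawMonoid ℚ.+-0-rawMonoid using () renaming (_×_ to _·_)
open import Data.Product using (∃-syntax; proj₁; _,_; _×_; uncurry)
open import Data.Sum using (_⊎_; inj₁; inj₂; [_,_])
open import Data.Empty using (⊥; ⊥-elim)
open import Function using (_∘_)
open import Function.Bundles using (_⇔_; mk⇔)
open import Function.Construct.Composition using (_⇔-∘_)
open import Relation.Nullary using (¬_; yes; no)
open import Relation.Binary.PropositionalEquality as ≡
  using (_≡_; _≢_; refl; trans; cong; cong₂; subst; subst₂; module ≡-Reasoning)

unique-reverse : ∀ {A : Set} {xs : List A} → Unique xs → Unique (List.reverse xs)
unique-reverse {xs = xs} =
  Permutation.Unique-resp-↭ (≡.setoid _) (↭⇒↭ₛ (↭-sym (↭-reverse xs)))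

lookup-injective : ∀ {A : Set} {xs : List A} → Unique xs →
                   ∀ i j → lookup xs i ≡ lookup xs j → i ≡ j
lookup-injective {xs = _ ∷ _} _          zero    zero    _  = refl
lookup-injective {xs = _ ∷ _} (x≢xs ∷ _) zero    (suc j) eq = ⊥-elim (All.lookup x≢xs (∈-lookup j) eq)
lookup-injective {xs = _ ∷ _} (x≢xs ∷ _) (suc i) zero    eq = ⊥-elim (All.lookup x≢xs (∈-lookup i) (≡.sym eq))
lookup-injective {xs = _ ∷ _} (_ ∷ u)    (suc i) (suc j) eq = cong suc (lookup-injective u i j eq)

unique-length≤ : ∀ {s} (xs : List (Fin s)) → Unique xs → length xs ℕ.≤ s
unique-length≤ {s} xs u with length xs ℕ.≤? s
... | yes ≤s = ≤s
... | no  ≰s =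
  let i , j , i<j , eq = pigeonhole (ℕ.≰⇒> ≰s) (lookup xs)
  in  ⊥-elim (<⇒≢ i<j (lookup-injective u i j eq))

module _ {m : ℕ} {A : Fin m → Fin m → Set} where

  start∈verts : ∀ {x y} (p : Walk A x y) → x ∈ verts A p
  start∈verts []      = here refl
  start∈verts (_ ∷ _) = here refl

  end∈verts : ∀ {x y} (p : Walk A x y) → y ∈ verts A p
  end∈verts []      = here refl
  end∈verts (_ ∷ p) = there (end∈verts p)

  closedWalk-¬unique : ∀ {x y} (e : A x y) (p : Walk A y x) → ¬ Unique (verts A (e ∷ p))
  closedWalk-¬unique e p u = Unique[x∷xs]⇒x∉xs u (end∈verts p)

  snoc : ∀ {x y z} → Walk A x y → A y z → Walk A x z
  snoc []      e = e ∷ []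
  snoc (f ∷ p) e = f ∷ snoc p e

  verts-snoc : ∀ {x y z} (p : Walk A x y) (e : A y z) → verts A (snoc p e) ≡ verts A p ∷ʳ z
  verts-snoc []            e = refl
  verts-snoc (_∷_ {x} f p) e = cong (x ∷_) (verts-snoc p e)

  module _ (A-sym : ∀ {x y} → A x y → A y x) where

    reverse : ∀ {x y} → Walk A x y → Walk A y x
    reverse []      = []
    reverse (e ∷ p) = snoc (reverse p) (A-sym e)

    verts-reverse : ∀ {x y} (p : Walk A x y) → verts A (reverse p) ≡ List.reverse (verts A p)
    verts-reverse []            = refl
    verts-reverse (_∷_ {x} e p) = begin
      verts A (snoc (reverse p) (A-sym e)) ≡⟨ verts-snoc (reverse p) (A-sym e) ⟩
      verts A (reverse p) ∷ʳ x              ≡⟨ cong (_∷ʳ x) (verts-reverse p) ⟩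
      List.reverse (verts A p) ∷ʳ x         ≡⟨ unfold-reverse x (verts A p) ⟨
      List.reverse (x ∷ verts A p)          ∎
      where open ≡-Reasoning

    reversePath : ∀ {x y} → Path A x y → Path A y x
    reversePath (p , u) = reverse p , subst Unique (≡.sym (verts-reverse p)) (unique-reverse u)

    length-reversePath : ∀ {x y} (p : Path A x y) →
                         length (verts A (proj₁ (reversePath p))) ≡ length (verts A (proj₁ p))
    length-reversePath (p , _) = trans (cong length (verts-reverse p)) (length-reverse (verts A p))

p≤p+q : ∀ p {q} → 0ℚ ≤ q → p ≤ p + q
p≤p+q p {q} 0≤q = subst (_≤ p + q) (ℚ.+-identityʳ p) (ℚ.+-monoʳ-≤ p 0≤q)

p<p+1 : ∀ p → p < p + 1ℚ
p<p+1 p = subst (_< p + 1ℚ) (ℚ.+-identityʳ p) (ℚ.+-monoʳ-< p (ℚ.positive⁻¹ 1ℚ))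

·-nonneg : ∀ n {x} → 0ℚ ≤ x → 0ℚ ≤ n · x
·-nonneg ℕ.zero  _   = ℚ.≤-refl
·-nonneg (suc n) 0≤x = ℚ.+-mono-≤ 0≤x (·-nonneg n 0≤x)

·-monoˡ-≤ : ∀ {m n x} → 0ℚ ≤ x → m ℕ.≤ n → m · x ≤ n · x
·-monoˡ-≤ {n = n} 0≤x z≤n       = ·-nonneg n 0≤x
·-monoˡ-≤ {x = x} 0≤x (s≤s m≤n) = ℚ.+-monoʳ-≤ x (·-monoˡ-≤ 0≤x m≤n)

module _ (T : WTree) where

  weight-nonneg : ∀ {x y} (p : Walk (E T) x y) → 0ℚ ≤ weight T p
  weight-nonneg []                = ℚ.≤-refl
  weight-nonneg (_∷_ {x} {y} _ p) = ℚ.+-mono-≤ (w-nonneg T x y) (weight-nonneg p)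

  weight-snoc : ∀ {x y z} (p : Walk (E T) x y) (e : E T y z) →
                weight T (snoc p e) ≡ weight T p + w T y z
  weight-snoc {x} {z = z} [] e = trans (ℚ.+-identityʳ (w T x z)) (≡.sym (ℚ.+-identityˡ (w T x z)))
  weight-snoc (_∷_ {x} {y} f p) e =
    trans (cong (w T x y +_) (weight-snoc p e)) (≡.sym (ℚ.+-assoc (w T x y) _ _))

  weight-reverse : ∀ {x y} (p : Walk (E T) x y) → weight T (reverse (E-sym T) p) ≡ weight T p
  weight-reverse []                = refl
  weight-reverse (_∷_ {x} {y} e p) = begin
    weight T (snoc (reverse (E-sym T) p) (E-sym T e)) ≡⟨ weight-snoc (reverse (E-sym T) p) (E-sym T e) ⟩
    weight T (reverse (E-sym T) p) + w T y x          ≡⟨ cong₂ _+_ (weight-reverse p) (w-sym T y x) ⟩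
    weight T p + w T x y                              ≡⟨ ℚ.+-comm (weight T p) (w T x y) ⟩
    w T x y + weight T p                              ∎
    where open ≡-Reasoning

  DistIn-sym : ∀ {x y S} → DistIn T x y S → DistIn T y x S
  DistIn-sym {S = S} (p , s) =
    reversePath (E-sym T) p , subst S (≡.sym (weight-reverse (proj₁ p))) s

  DistIn-comm : ∀ {x y} S → DistIn T x y S ⇔ DistIn T y x S
  DistIn-comm S = mk⇔ (DistIn-sym {S = S}) (DistIn-sym {S = S})

  DistIn-map : ∀ {x y} {S S′ : ℚ → Set} → (∀ {r} → S r → S′ r) → DistIn T x y S → DistIn T x y S′
  DistIn-map f (p , s) = p , f s

  edgeWeights : List ℚ
  edgeWeights = map (uncurry (w T)) (cartesianProduct (allFin (size T)) (allFin (size T)))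

  maxWeight : ℚ
  maxWeight = max 0ℚ edgeWeights

  0≤maxWeight : 0ℚ ≤ maxWeight
  0≤maxWeight = ⊥≤max 0ℚ edgeWeights

  w≤maxWeight : ∀ x y → w T x y ≤ maxWeight
  w≤maxWeight x y = All.lookup (xs≤max 0ℚ edgeWeights)
    (∈-map⁺ (uncurry (w T)) (∈-cartesianProduct⁺ (∈-allFin x) (∈-allFin y)))

  weight≤length·maxWeight : ∀ {x y} (p : Walk (E T) x y) →
                            weight T p ≤ length (verts (E T) p) · maxWeight
  weight≤length·maxWeight []                = ℚ.+-mono-≤ 0≤maxWeight ℚ.≤-refl
  weight≤length·maxWeight (_∷_ {x} {y} _ p) = ℚ.+-mono-≤ (w≤maxWeight x y) (weight≤length·maxWeight p)

  pathBound : ℚ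
  pathBound = size T · maxWeight

  0≤pathBound : 0ℚ ≤ pathBound
  0≤pathBound = ·-nonneg (size T) 0≤maxWeight

  weight≤pathBound : ∀ {x y} (p : Path (E T) x y) → weight T (proj₁ p) ≤ pathBound
  weight≤pathBound (p , u) =
    ℚ.≤-trans (weight≤length·maxWeight p) (·-monoˡ-≤ 0≤maxWeight (unique-length≤ (verts (E T) p) u))

  DistIn-map≤ : ∀ {x y} {S S′ : ℚ → Set} → (∀ {r} → r ≤ pathBound → S r → S′ r) →
                DistIn T x y S → DistIn T x y S′
  DistIn-map≤ f (p , s) = p , f (weight≤pathBound p) s

boundValue : Bound → ℚ
boundValue (closedB a) = a
boundValue (openB a)   = a
boundValue unbounded   = 0ℚ

emptyInterval : Interval
emptyInterval = interval (openB 0ℚ) (openB 0ℚ)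

∉emptyInterval : ∀ {r} → ¬ r ∈I emptyInterval
∉emptyInterval (_ , 0<r , r<0) = ℚ.<-asym 0<r r<0

-- The part of (K, ∞) that I misses, once K exceeds the endpoints of I.
beyond : Interval → ℚ → Interval
beyond (interval _ unbounded)   K = emptyInterval
beyond (interval _ (closedB _)) K = interval (openB K) unbounded
beyond (interval _ (openB _))   K = interval (openB K) unbounded

≤⇒∉beyond : ∀ I {K r} → r ≤ K → ¬ r ∈I beyond I K
≤⇒∉beyond (interval _ unbounded)   _   = ∉emptyInterval
≤⇒∉beyond (interval _ (closedB _)) r≤K (_ , K<r , _) = ℚ.<-irrefl refl (ℚ.≤-<-trans r≤K K<r)
≤⇒∉beyond (interval _ (openB _))   r≤K (_ , K<r , _) = ℚ.<-irrefl refl (ℚ.≤-<-trans r≤K K<r)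

beyond-disjoint : ∀ I {K r} → boundValue (upper I) ≤ K → r ∈I I → ¬ r ∈I beyond I K
beyond-disjoint (interval _ unbounded)   _   _             = ∉emptyInterval
beyond-disjoint I@(interval _ (closedB _)) b≤K (_ , _ , r≤b) = ≤⇒∉beyond I (ℚ.≤-trans r≤b b≤K)
beyond-disjoint I@(interval _ (openB _))   b≤K (_ , _ , r<b) = ≤⇒∉beyond I (ℚ.≤-trans (ℚ.<⇒≤ r<b) b≤K)

above-lower : ∀ b {r} → boundValue b < r → 0ℚ ≤ r → AboveL b r
above-lower (closedB _) b<r _   = ℚ.<⇒≤ b<r
above-lower (openB _)   b<r _   = b<r
above-lower unbounded   _   0≤r = 0≤r

beyond-covers : ∀ I {K r} → boundValue (lower I) ≤ K → 0ℚ ≤ K → K < r → r ∈I I ⊎ r ∈I beyond I K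
beyond-covers I {K} {r} lower≤K 0≤K K<r = cover I lower≤K
  where
  0≤r : 0ℚ ≤ r
  0≤r = ℚ.<⇒≤ (ℚ.≤-<-trans 0≤K K<r)

  cover : ∀ I → boundValue (lower I) ≤ K → r ∈I I ⊎ r ∈I beyond I K
  cover (interval a unbounded)   a≤K = inj₁ (0≤r , above-lower a (ℚ.≤-<-trans a≤K K<r) 0≤r , 0≤r)
  cover (interval _ (closedB _)) _   = inj₂ (0≤r , K<r , 0≤r)
  cover (interval _ (openB _))   _   = inj₂ (0≤r , K<r , 0≤r)

record LeafLabellingAvoiding (k : ℕ) (T : WTree) (c : Fin (size T)) : Set where
  field
    label           : Fin k → Fin (size T)
    label-injective : ∀ a b → label a ≡ label b → a ≡ b
    label-leaf      : ∀ a → Leaf T (label a)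
    label-≢         : ∀ a → label a ≢ c
    label-onto      : ∀ x → Leaf T x → x ≢ c → ∃[ a ] label a ≡ x

avoiding-first : ∀ {k T} (L : LeafLabelling (suc k) T) → LeafLabellingAvoiding k T (ℓ L zero)
avoiding-first {T = T} L = record
  { label           = ℓ L ∘ suc
  ; label-injective = λ a b → suc-injective ∘ ℓ-inj L (suc a) (suc b)
  ; label-leaf      = ℓ-leaf L ∘ suc
  ; label-≢         = λ a eq → 0≢1+n (≡.sym (ℓ-inj L (suc a) zero eq))
  ; label-onto      = onto
  }
  where
  onto : ∀ x → Leaf T x → x ≢ ℓ L zero → ∃[ a ] ℓ L (suc a) ≡ x
  onto x leaf x≢c with ℓ-onto L x leaf
  ... | zero  , refl = ⊥-elim (x≢c refl)
  ... | suc a , eq   = a , eq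

avoiding⇒labelling : ∀ {k T c y z} → LeafLabellingAvoiding k T c →
                     E T c y → E T c z → y ≢ z → LeafLabelling k T
avoiding⇒labelling {y = y} {z} L c~y c~z y≢z = record
  { ℓ      = label
  ; ℓ-inj  = label-injective
  ; ℓ-leaf = label-leaf
  ; ℓ-onto = λ x leaf → label-onto x leaf λ { refl → y≢z (leaf y z c~y c~z) }
  }
  where open LeafLabellingAvoiding L

⟨$⟩ˡ-injective : ∀ {k} (π : Permutation′ k) {a b} → π ⟨$⟩ˡ a ≡ π ⟨$⟩ˡ b → a ≡ b
⟨$⟩ˡ-injective π eq = trans (≡.sym (inverseʳ π)) (trans (cong (π ⟨$⟩ʳ_) eq) (inverseʳ π))

permuteLabelling : ∀ {k T} → Permutation′ k → LeafLabelling k T → LeafLabelling k T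
permuteLabelling π L = record
  { ℓ      = λ a → ℓ L (π ⟨$⟩ˡ a)
  ; ℓ-inj  = λ a b → ⟨$⟩ˡ-injective π ∘ ℓ-inj L _ _
  ; ℓ-leaf = λ a → ℓ-leaf L (π ⟨$⟩ˡ a)
  ; ℓ-onto = λ x leaf → let a , ℓa≡x = ℓ-onto L x leaf
                        in  π ⟨$⟩ʳ a , trans (cong (ℓ L) (inverseˡ π)) ℓa≡x
  }

⇔-reindex : ∀ {k} (π : Permutation′ k) {R Q : Fin k → Fin k → Set} →
            (∀ a b → a ≢ b → R (π ⟨$⟩ʳ a) (π ⟨$⟩ʳ b) ⇔ Q a b) →
            ∀ a b → a ≢ b → R a b ⇔ Q (π ⟨$⟩ˡ a) (π ⟨$⟩ˡ b)
⇔-reindex π {R} {Q} h a b a≢b =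
  subst₂ (λ a′ b′ → R a′ b′ ⇔ Q (π ⟨$⟩ˡ a) (π ⟨$⟩ˡ b)) (inverseʳ π) (inverseʳ π) (h _ _ (a≢b ∘ ⟨$⟩ˡ-injective π))

-- T with a new leaf zero joined to c by an edge of weight d; old nodes are shifted by suc.
module Attach (T : WTree) (c : Fin (size T)) (d : ℚ) (0≤d : 0ℚ ≤ d) where

  Node : Set
  Node = Fin (suc (size T))

  E⁺ : Node → Node → Set
  E⁺ zero    zero    = ⊥
  E⁺ zero    (suc y) = y ≡ c
  E⁺ (suc x) zero    = x ≡ c
  E⁺ (suc x) (suc y) = E T x y

  E⁺-sym : ∀ {x y} → E⁺ x y → E⁺ y x
  E⁺-sym {zero}  {suc _} e = e
  E⁺-sym {suc _} {zero}  e = e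
  E⁺-sym {suc _} {suc _} e = E-sym T e

  E⁺-irrefl : ∀ {x} → ¬ E⁺ x x
  E⁺-irrefl {suc _} = E-irrefl T

  w⁺ : Node → Node → ℚ
  w⁺ zero    _       = d
  w⁺ (suc _) zero    = d
  w⁺ (suc x) (suc y) = w T x y

  w⁺-sym : ∀ x y → w⁺ x y ≡ w⁺ y x
  w⁺-sym zero    zero    = refl
  w⁺-sym zero    (suc _) = refl
  w⁺-sym (suc _) zero    = refl
  w⁺-sym (suc x) (suc y) = w-sym T x y

  w⁺-nonneg : ∀ x y → 0ℚ ≤ w⁺ x y
  w⁺-nonneg zero    _       = 0≤d
  w⁺-nonneg (suc _) zero    = 0≤d
  w⁺-nonneg (suc x) (suc y) = w-nonneg T x y

  lift : ∀ {x y} → Walk (E T) x y → Walk E⁺ (suc x) (suc y)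
  lift []      = []
  lift (e ∷ p) = e ∷ lift p

  verts-lift : ∀ {x y} (p : Walk (E T) x y) → verts E⁺ (lift p) ≡ map suc (verts (E T) p)
  verts-lift []            = refl
  verts-lift (_∷_ {x} e p) = cong (suc x ∷_) (verts-lift p)

  unique-lift : ∀ {x y} (p : Walk (E T) x y) → Unique (verts (E T) p) → Unique (verts E⁺ (lift p))
  unique-lift p u = subst Unique (≡.sym (verts-lift p)) (map⁺ suc-injective u)

  unique-unlift : ∀ {x y} (p : Walk (E T) x y) → Unique (verts E⁺ (lift p)) → Unique (verts (E T) p)
  unique-unlift p u = map⁻ (subst Unique (verts-lift p) u)

  length-lift : ∀ {x y} (p : Walk (E T) x y) → length (verts E⁺ (lift p)) ≡ length (verts (E T) p)
  length-lift p = trans (cong length (verts-lift p)) (length-map suc (verts (E T) p))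

  zero∉lift : ∀ {x y} (p : Walk (E T) x y) → All (zero ≢_) (verts E⁺ (lift p))
  zero∉lift []      = (λ ()) ∷ []
  zero∉lift (_ ∷ p) = (λ ()) ∷ zero∉lift p

  liftPath : ∀ {x y} → Path (E T) x y → Path E⁺ (suc x) (suc y)
  liftPath (p , u) = lift p , unique-lift p u

  pathFromNew : ∀ {y} → Path (E T) c y → Path E⁺ zero (suc y)
  pathFromNew (p , u) = refl ∷ lift p , zero∉lift p ∷ unique-lift p u

  -- A path between old nodes cannot pass through zero: it would visit suc c twice.
  unique⇒lifted : ∀ {x y} (p : Walk E⁺ (suc x) (suc y)) → Unique (verts E⁺ p) → ∃[ q ] lift q ≡ p
  unique⇒lifted [] _ = [] , refl
  unique⇒lifted (_∷_ {y = suc _} e p) (_ ∷ u) =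
    let q , lift-q≡p = unique⇒lifted p u in e ∷ q , cong (e ∷_) lift-q≡p
  unique⇒lifted (_∷_ {y = zero} refl (_∷_ {y = suc _} refl p)) u =
    ⊥-elim (Unique[x∷xs]⇒x∉xs u (there (start∈verts p)))

  E⁺-connected : Connected E⁺
  E⁺-connected zero    zero    = [] , [] ∷ []
  E⁺-connected zero    (suc y) = pathFromNew (connected T c y)
  E⁺-connected (suc x) zero    = reversePath (λ {x y} → E⁺-sym {x} {y}) (pathFromNew (connected T c x))
  E⁺-connected (suc x) (suc y) = liftPath (connected T x y)

  acyclic-fromNew : ∀ y (p : Path E⁺ zero (suc y)) →
                    3 ℕ.≤ length (verts E⁺ (proj₁ p)) → ¬ E⁺ (suc y) zero
  acyclic-fromNew y (_∷_ {y = suc _} refl []      , _)     (s≤s (s≤s ())) _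
  acyclic-fromNew y (_∷_ {y = suc _} refl (e ∷ p) , _ ∷ u) _              refl =
    closedWalk-¬unique e p u

  E⁺-acyclic : Acyclic E⁺
  E⁺-acyclic zero    zero    ([] , _)      (s≤s ()) _
  E⁺-acyclic zero    zero    (e ∷ p , u)   _        _ = closedWalk-¬unique e p u
  E⁺-acyclic zero    (suc y) p             = acyclic-fromNew y p
  E⁺-acyclic (suc x) zero    p         len e =
    acyclic-fromNew x (reversePath (λ {x y} → E⁺-sym {x} {y}) p)
      (subst (3 ℕ.≤_) (≡.sym (length-reversePath (λ {x y} → E⁺-sym {x} {y}) p)) len) (E⁺-sym {zero} {suc x} e)
  E⁺-acyclic (suc x) (suc y) (p , u)   len e with unique⇒lifted p u
  ... | q , refl = acyclic T x y (q , unique-unlift q u) (subst (3 ℕ.≤_) (length-lift q) len) e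

  T⁺ : WTree
  T⁺ = record
    { size      = suc (size T)
    ; E         = E⁺
    ; E-sym     = λ {x y} → E⁺-sym {x} {y}
    ; E-irrefl  = λ {x} → E⁺-irrefl {x}
    ; connected = E⁺-connected
    ; acyclic   = E⁺-acyclic
    ; w         = w⁺
    ; w-sym     = w⁺-sym
    ; w-nonneg  = w⁺-nonneg
    }

  weight-lift : ∀ {x y} (p : Walk (E T) x y) → weight T⁺ (lift p) ≡ weight T p
  weight-lift []                = refl
  weight-lift (_∷_ {x} {y} e p) = cong (w T x y +_) (weight-lift p)

  weight-fromNew : ∀ {y} (p : Walk E⁺ zero y) → y ≢ zero → d ≤ weight T⁺ p
  weight-fromNew []      0≢0 = ⊥-elim (0≢0 refl)
  weight-fromNew (_ ∷ p) _   = p≤p+q d (weight-nonneg T⁺ p)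

  DistIn-lift : ∀ {x y} S → DistIn T x y S ⇔ DistIn T⁺ (suc x) (suc y) S
  DistIn-lift {x} {y} S = mk⇔ to from
    where
    to : DistIn T x y S → DistIn T⁺ (suc x) (suc y) S
    to ((p , u) , s) = liftPath (p , u) , subst S (≡.sym (weight-lift p)) s

    from : DistIn T⁺ (suc x) (suc y) S → DistIn T x y S
    from ((p , u) , s) with unique⇒lifted p u
    ... | q , refl = (q , unique-unlift q u) , subst S (weight-lift q) s

  DistIn-fromNew : ∀ {y} S → DistIn T c y (λ r → S (d + r)) ⇔ DistIn T⁺ zero (suc y) S
  DistIn-fromNew {y} S = mk⇔ to from
    where
    to : DistIn T c y (λ r → S (d + r)) → DistIn T⁺ zero (suc y) S
    to ((p , u) , s) = pathFromNew (p , u) , subst (λ r → S (d + r)) (≡.sym (weight-lift p)) s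

    from : DistIn T⁺ zero (suc y) S → DistIn T c y (λ r → S (d + r))
    from ((_∷_ {y = suc _} refl p , _ ∷ u) , s) with unique⇒lifted p u
    ... | q , refl = (q , unique-unlift q u) , subst (λ r → S (d + r)) (weight-lift q) s

  leaf-new : Leaf T⁺ zero
  leaf-new (suc _) (suc _) refl refl = refl

  leaf-lift : ∀ {x} → Leaf T x → x ≢ c → Leaf T⁺ (suc x)
  leaf-lift _    x≢c zero    _       x≡c _   = ⊥-elim (x≢c x≡c)
  leaf-lift _    x≢c (suc _) zero    _   x≡c = ⊥-elim (x≢c x≡c)
  leaf-lift leaf _   (suc y) (suc z) x~y x~z = cong suc (leaf y z x~y x~z)

  leaf-unlift : ∀ {x} → Leaf T⁺ (suc x) → Leaf T x
  leaf-unlift leaf y z x~y x~z = suc-injective (leaf (suc y) (suc z) x~y x~z)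

  attach-avoiding : ∀ {k} → LeafLabellingAvoiding k T c → LeafLabellingAvoiding (suc k) T⁺ (suc c)
  attach-avoiding L = record
    { label           = Fin.lift 1 label
    ; label-injective = λ a b → lift-injective label (label-injective _ _) 1
    ; label-leaf      = λ { zero → leaf-new ; (suc a) → leaf-lift (label-leaf a) (label-≢ a) }
    ; label-≢         = λ { zero () ; (suc a) → label-≢ a ∘ suc-injective }
    ; label-onto      = onto
    }
    where
    open LeafLabellingAvoiding L

    onto : ∀ x → Leaf T⁺ x → x ≢ suc c → ∃[ a ] Fin.lift 1 label a ≡ x
    onto zero    _    _   = zero , refl
    onto (suc x) leaf x≢c =
      let a , label-a≡x = label-onto x (leaf-unlift leaf) (x≢c ∘ cong suc)
      in  suc a , cong suc label-a≡x

pointTree : WTree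
pointTree = record
  { size      = 1
  ; E         = λ _ _ → ⊥
  ; E-sym     = λ ()
  ; E-irrefl  = λ ()
  ; connected = λ { zero zero → [] , [] ∷ [] }
  ; acyclic   = λ _ _ _ _ ()
  ; w         = λ _ _ → 0ℚ
  ; w-sym     = λ _ _ → refl
  ; w-nonneg  = λ _ _ → ℚ.≤-refl
  }

graph₁-is2IntervalPCG : (G : Graph 1) → Is2IntervalPCG G
graph₁-is2IntervalPCG G =
  pointTree , labelling , emptyInterval , emptyInterval ,
  (λ _ (r∈∅ , _) → ∉emptyInterval r∈∅) , λ { zero zero 0≢0 → ⊥-elim (0≢0 refl) }
  where
  labelling : LeafLabelling 1 pointTree
  labelling = record
    { ℓ      = λ a → a
    ; ℓ-inj  = λ { zero zero _ → refl }
    ; ℓ-leaf = λ _ _ _ ()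
    ; ℓ-onto = λ x _ → x , refl
    }

-- In T₂ the node zero is q, suc zero is p, and suc (suc x) is the node x of T.
module FarLeaf {n : ℕ} (T : WTree) (L : LeafLabelling (suc n) T) (I : Interval) where

  c : Fin (size T)
  c = ℓ L zero

  module A₁ = Attach T c 0ℚ ℚ.≤-refl

  lo hi : ℚ
  lo = boundValue (lower I)
  hi = boundValue (upper I)

  K : ℚ
  K = lo ⊔ hi ⊔ pathBound T

  lo≤K : lo ≤ K
  lo≤K = ℚ.≤-trans (ℚ.p≤p⊔q lo hi) (ℚ.p≤p⊔q (lo ⊔ hi) (pathBound T))

  hi≤K : hi ≤ K
  hi≤K = ℚ.≤-trans (ℚ.p≤q⊔p lo hi) (ℚ.p≤p⊔q (lo ⊔ hi) (pathBound T))

  pathBound≤K : pathBound T ≤ K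
  pathBound≤K = ℚ.p≤q⊔p (lo ⊔ hi) (pathBound T)

  0≤K : 0ℚ ≤ K
  0≤K = ℚ.≤-trans (0≤pathBound T) pathBound≤K

  D : ℚ
  D = K + 1ℚ

  K<D : K < D
  K<D = p<p+1 K

  module A₂ = Attach A₁.T⁺ (suc c) D (ℚ.<⇒≤ (ℚ.≤-<-trans 0≤K K<D))

  T₂ : WTree
  T₂ = A₂.T⁺

  J : Interval
  J = beyond I K

  _∈I∪J : ℚ → Set
  r ∈I∪J = r ∈I I ⊎ r ∈I J

  J-disjoint : ∀ r → ¬ (r ∈I I × r ∈I J)
  J-disjoint r (r∈I , r∈J) = beyond-disjoint I hi≤K r∈I r∈J

  L₂ : LeafLabelling (suc (suc n)) T₂
  L₂ = avoiding⇒labelling {y = zero} {z = suc zero}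
         (A₂.attach-avoiding (A₁.attach-avoiding (avoiding-first L))) refl refl λ ()

  far-distance : ∀ a → DistIn T₂ zero (ℓ L₂ (suc a)) _∈I∪J
  far-distance a =
    let p = connected T₂ zero (ℓ L₂ (suc a))
    in  p , beyond-covers I lo≤K 0≤K (ℚ.<-≤-trans K<D (A₂.weight-fromNew (proj₁ p) λ ()))

  DistIn-I⇔I∪J : ∀ {x y} → DistIn T x y (_∈I I) ⇔ DistIn T x y _∈I∪J
  DistIn-I⇔I∪J = mk⇔ (DistIn-map T {S′ = _∈I∪J} inj₁) (DistIn-map≤ T {S = _∈I∪J} ∈I∪J⇒∈I)
    where
    ∈I∪J⇒∈I : ∀ {r} → r ≤ pathBound T → r ∈I∪J → r ∈I I
    ∈I∪J⇒∈I _       (inj₁ r∈I) = r∈I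
    ∈I∪J⇒∈I r≤bound (inj₂ r∈J) = ⊥-elim (≤⇒∉beyond I (ℚ.≤-trans r≤bound pathBound≤K) r∈J)

  p-replaces-c : ∀ {y} S → DistIn T c y S ⇔ DistIn A₁.T⁺ zero (suc y) S
  p-replaces-c S = A₁.DistIn-fromNew S ⇔-∘ mk⇔ (DistIn-map T {S = S} 0+) (DistIn-map T {S′ = S} 0+⁻¹)
    where
    0+ : ∀ {r} → S r → S (0ℚ + r)
    0+ = subst S (≡.sym (ℚ.+-identityˡ _))

    0+⁻¹ : ∀ {r} → S (0ℚ + r) → S r
    0+⁻¹ = subst S (ℚ.+-identityˡ _)

  distance-in-T₁ : ∀ i j → i ≢ j → ∀ S → DistIn T (ℓ L i) (ℓ L j) S ⇔
                   DistIn A₁.T⁺ (Fin.lift 1 (ℓ L ∘ suc) i) (Fin.lift 1 (ℓ L ∘ suc) j) S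
  distance-in-T₁ zero    zero    0≢0 _ = ⊥-elim (0≢0 refl)
  distance-in-T₁ zero    (suc j) _   S = p-replaces-c S
  distance-in-T₁ (suc i) zero    _   S = DistIn-comm A₁.T⁺ S ⇔-∘ (p-replaces-c S ⇔-∘ DistIn-comm T S)
  distance-in-T₁ (suc i) (suc j) _   S = A₁.DistIn-lift S

  near-distance : ∀ i j → i ≢ j →
                  DistIn T (ℓ L i) (ℓ L j) (_∈I I) ⇔ DistIn T₂ (ℓ L₂ (suc i)) (ℓ L₂ (suc j)) _∈I∪J
  near-distance i j i≢j = A₂.DistIn-lift _∈I∪J ⇔-∘ (distance-in-T₁ i j i≢j _∈I∪J ⇔-∘ DistIn-I⇔I∪J)

theorem1 : ∀ {n : ℕ} (G : Graph (suc n)) (u : Fin (suc n)) →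
           Universal G u → IsPCG (removeNode G u) → Is2IntervalPCG G
theorem1 {ℕ.zero} G u _ _ = graph₁-is2IntervalPCG G
theorem1 {suc n}  G u universal (T , L , I , model) =
  T₂ , permuteLabelling ρ L₂ , I , J , J-disjoint , ⇔-reindex ρ adjacency
  where
  open FarLeaf T L I

  -- ρ zero = u and ρ (suc i) = punchIn u i, matching the vertex order of L₂.
  ρ : Permutation′ (suc (suc n))
  ρ = insert zero u id

  adjacency : ∀ a b → a ≢ b →
              Adj G (ρ ⟨$⟩ʳ a) (ρ ⟨$⟩ʳ b) ⇔ DistIn T₂ (ℓ L₂ a) (ℓ L₂ b) _∈I∪J
  adjacency zero    zero    0≢0 = ⊥-elim (0≢0 refl)
  adjacency zero    (suc j) _   =
    mk⇔ (λ _ → far-distance j) (λ _ → universal (punchIn u j) (punchInᵢ≢i u j))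
  adjacency (suc i) zero    _   =
    mk⇔ (λ _ → DistIn-sym T₂ {S = _∈I∪J} (far-distance i))
        (λ _ → sym G (universal (punchIn u i) (punchInᵢ≢i u i)))
  adjacency (suc i) (suc j) i≢j =
    near-distance i j (i≢j ∘ cong suc) ⇔-∘ model i j (i≢j ∘ cong suc)
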